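{- In the matrix $\mathcal{M}_6$ the following hold: (1) for all $z,w\in B_{LET_K}$, $z\,\tilde\equiv\,w\in\mathrm{D}$ iff $z=w$; (2) for all formulas $A,B$ and every valuation $v$ over $\mathcal{M}_6$, $v(A\equiv B)\in\mathrm{D}$ iff $v(A)=v(B)$; (3) $\models_{\mathcal{M}_6}A\equiv A$ for every formula $A$; (4) $A\equiv B\models_{\mathcal{M}_6}B\equiv A$ for all formulas $A,B$; (5) $A\equiv B,\ B\equiv C\models_{\mathcal{M}_6}A\equiv C$ for all formulas $A,B,C$; (6) $A\equiv B\models_{\mathcal{M}_6}\#A\equiv\#B$ for all formulas $A,B$ and $\#\in\{\neg,\circ\}$; (7) $A\equiv B,\ C\equiv D\models_{\mathcal{M}_6}(A\#C)\equiv(B\#D)$ for all formulas $A,B,C,D$ and $\#\in\{\land,\lor,\to\}$; (8) $A\equiv(A\to A)\models_{\mathcal{M}_6}A$ and $A\models_{\mathcal{M}_6}A\equiv(A\to A)$ for every formula $A$.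
   Context: Formulas are built from a denumerable set of propositional variables over $\Sigma=\{\land,\lor,\to,\neg,\circ\}$. Let $\{0,1\}$ be the two-element Boolean algebra with $\sqcap,\sqcup,\sim$, $a\Rightarrow b=\sim a\sqcup b$. $\mathcal{M}_6$ is the logical matrix with domain $B_{LET_K}=\{z\in\{0,1\}^3:z_3\le z_1\sqcup z_2,\ z_1\sqcap z_2\sqcap z_3=0\}=\{T=(1,0,1),T_0=(1,0,0),\mathsf{b}=(1,1,0),\mathsf{n}=(0,0,0),F_0=(0,1,0),F=(0,1,1)\}$, designated set $\mathrm{D}=\{T,T_0,\mathsf{b}\}$, and operations: $z\tilde\land w=(z_1\sqcap w_1,\ z_2\sqcup w_2,\ (z_1\sqcap z_3\sqcap w_1\sqcap w_3)\sqcup(z_2\sqcap z_3)\sqcup(w_2\sqcap w_3))$; $z\tilde\lor w=(z_1\sqcup w_1,\ z_2\sqcap w_2,\ (z_2\sqcap z_3\sqcap w_2\sqcap w_3)\sqcup(z_1\sqcap z_3)\sqcup(w_1\sqcap w_3))$; $z\tilde\to w=(z_1\Rightarrow w_1,\ z_1\sqcap w_2,\ (z_1\sqcap w_2\sqcap w_3)\sqcup(z_2\sqcap z_3)\sqcup(w_1\sqcap w_3))$; $\tilde\neg z=(z_2,z_1,z_3)$; $\tilde\circ z=(z_3,\sim z_3,1)$. A valuation is a homomorphism from the formula algebra into this algebra; $\Gamma\models_{\mathcal{M}_6}A$ iff every valuation sending all of $\Gamma$ into $\mathrm{D}$ sends $A$ into $\mathrm{D}$ ($\models_{\mathcal{M}_6}A$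 is the case $\Gamma=\emptyset$). Define $A\leftrightarrow B$ as $(A\to B)\land(B\to A)$ and $A\equiv B$ as $(A\leftrightarrow B)\land(\neg A\leftrightarrow\neg B)\land(\circ A\leftrightarrow\circ B)$; correspondingly $z\tilde\leftrightarrow w=(z\tilde\to w)\tilde\land(w\tilde\to z)$ and $z\tilde\equiv w=(z\tilde\leftrightarrow w)\tilde\land(\tilde\neg z\tilde\leftrightarrow\tilde\neg w)\tilde\land(\tilde\circ z\tilde\leftrightarrow\tilde\circ w)$. -}

module Defs where

open import Data.Bool using (Bool; true; false; _∧_; _∨_; not; T)
open import Data.Product using (Σ; _×_; _,_; proj₁; proj₂)
open import Data.Nat using (ℕ)
open import Data.Sum using (_⊎_)
open import Relation.Binary.PropositionalEquality using (_≡_)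
open import Data.List using (List; [])
open import Data.List.Relation.Unary.All using (All)

_⇒_ : Bool → Bool → Bool
a ⇒ b = not a ∨ b

Triple : Set
Triple = Bool × Bool × Bool

isB : Triple → Bool
isB (z1 , z2 , z3) = (z3 ⇒ (z1 ∨ z2)) ∧ not (z1 ∧ z2 ∧ z3)

B : Set
B = Σ Triple (λ z → T (isB z))

andR : Triple → Triple → Triple
andR (z1 , z2 , z3) (w1 , w2 , w3) =
  (z1 ∧ w1 , z2 ∨ w2 , (z1 ∧ z3 ∧ w1 ∧ w3) ∨ (z2 ∧ z3) ∨ (w2 ∧ w3))

orR : Triple → Triple → Triple
orR (z1 , z2 , z3) (w1 , w2 , w3) =
  (z1 ∨ w1 , z2 ∧ w2 , (z2 ∧ z3 ∧ w2 ∧ w3) ∨ (z1 ∧ z3) ∨ (w1 ∧ w3))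

impR : Triple → Triple → Triple
impR (z1 , z2 , z3) (w1 , w2 , w3) =
  (z1 ⇒ w1 , z1 ∧ w2 , (z1 ∧ w2 ∧ w3) ∨ (z2 ∧ z3) ∨ (w1 ∧ w3))

negR : Triple → Triple
negR (z1 , z2 , z3) = (z2 , z1 , z3)

circR : Triple → Triple
circR (z1 , z2 , z3) = (z3 , not z3 , true)

andR-B : (z w : Triple) → T (isB z) → T (isB w) → T (isB (andR z w))
andR-B (false , false , false) (false , false , false) _ _ = _
andR-B (false , false , false) (false , false , true) _ ()
andR-B (false , false , false) (false , true , false) _ _ = _
andR-B (false , false , false) (false , true , true) _ _ = _
andR-B (false , false , false) (true , false , false) _ _ = _
andR-B (false , false , false) (true , false , true) _ _ = _
andR-B (false , false , false) (true , true , false) _ _ = _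
andR-B (false , false , false) (true , true , true) _ ()
andR-B (false , false , true) (false , false , false) () _
andR-B (false , false , true) (false , false , true) () _
andR-B (false , false , true) (false , true , false) () _
andR-B (false , false , true) (false , true , true) () _
andR-B (false , false , true) (true , false , false) () _
andR-B (false , false , true) (true , false , true) () _
andR-B (false , false , true) (true , true , false) () _
andR-B (false , false , true) (true , true , true) () _
andR-B (false , true , false) (false , false , false) _ _ = _
andR-B (false , true , false) (false , false , true) _ ()
andR-B (false , true , false) (false , true , false) _ _ = _
andR-B (false , true , false) (false , true , true) _ _ = _
andR-B (false , true , false) (true , false , false) _ _ = _
andR-B (false , true , false) (true , false , true) _ _ = _
andR-B (false , true , false) (true , true , false) _ _ = _
andR-B (false , true , false) (true , true , true) _ ()
andR-B (false , true , true) (false , false , false) _ _ = _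
andR-B (false , true , true) (false , false , true) _ ()
andR-B (false , true , true) (false , true , false) _ _ = _
andR-B (false , true , true) (false , true , true) _ _ = _
andR-B (false , true , true) (true , false , false) _ _ = _
andR-B (false , true , true) (true , false , true) _ _ = _
andR-B (false , true , true) (true , true , false) _ _ = _
andR-B (false , true , true) (true , true , true) _ ()
andR-B (true , false , false) (false , false , false) _ _ = _
andR-B (true , false , false) (false , false , true) _ ()
andR-B (true , false , false) (false , true , false) _ _ = _
andR-B (true , false , false) (false , true , true) _ _ = _
andR-B (true , false , false) (true , false , false) _ _ = _
andR-B (true , false , false) (true , false , true) _ _ = _
andR-B (true , false , false) (true , true , false) _ _ = _
andR-B (true , false , false) (true , true , true) _ ()
andR-B (true , false , true) (false , false , false) _ _ = _
andR-B (true , false , true) (false , false , true) _ ()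
andR-B (true , false , true) (false , true , false) _ _ = _
andR-B (true , false , true) (false , true , true) _ _ = _
andR-B (true , false , true) (true , false , false) _ _ = _
andR-B (true , false , true) (true , false , true) _ _ = _
andR-B (true , false , true) (true , true , false) _ _ = _
andR-B (true , false , true) (true , true , true) _ ()
andR-B (true , true , false) (false , false , false) _ _ = _
andR-B (true , true , false) (false , false , true) _ ()
andR-B (true , true , false) (false , true , false) _ _ = _
andR-B (true , true , false) (false , true , true) _ _ = _
andR-B (true , true , false) (true , false , false) _ _ = _
andR-B (true , true , false) (true , false , true) _ _ = _
andR-B (true , true , false) (true , true , false) _ _ = _
andR-B (true , true , false) (true , true , true) _ ()
andR-B (true , true , true) (false , false , false) () _
andR-B (true , true , true) (false , false , true) () _
andR-B (true , true , true) (false , true , false) () _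
andR-B (true , true , true) (false , true , true) () _
andR-B (true , true , true) (true , false , false) () _
andR-B (true , true , true) (true , false , true) () _
andR-B (true , true , true) (true , true , false) () _
andR-B (true , true , true) (true , true , true) () _

orR-B : (z w : Triple) → T (isB z) → T (isB w) → T (isB (orR z w))
orR-B (false , false , false) (false , false , false) _ _ = _
orR-B (false , false , false) (false , false , true) _ ()
orR-B (false , false , false) (false , true , false) _ _ = _
orR-B (false , false , false) (false , true , true) _ _ = _
orR-B (false , false , false) (true , false , false) _ _ = _
orR-B (false , false , false) (true , false , true) _ _ = _
orR-B (false , false , false) (true , true , false) _ _ = _
orR-B (false , false , false) (true , true , true) _ ()
orR-B (false , false , true) (false , false , false) () _
orR-B (false , false , true) (false , false , true) () _
orR-B (false , false , true) (false , true , false) () _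
orR-B (false , false , true) (false , true , true) () _
orR-B (false , false , true) (true , false , false) () _
orR-B (false , false , true) (true , false , true) () _
orR-B (false , false , true) (true , true , false) () _
orR-B (false , false , true) (true , true , true) () _
orR-B (false , true , false) (false , false , false) _ _ = _
orR-B (false , true , false) (false , false , true) _ ()
orR-B (false , true , false) (false , true , false) _ _ = _
orR-B (false , true , false) (false , true , true) _ _ = _
orR-B (false , true , false) (true , false , false) _ _ = _
orR-B (false , true , false) (true , false , true) _ _ = _
orR-B (false , true , false) (true , true , false) _ _ = _
orR-B (false , true , false) (true , true , true) _ ()
orR-B (false , true , true) (false , false , false) _ _ = _
orR-B (false , true , true) (false , false , true) _ ()
orR-B (false , true , true) (false , true , false) _ _ = _
orR-B (false , true , true) (false , true , true) _ _ = _
orR-B (false , true , true) (true , false , false) _ _ = _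
orR-B (false , true , true) (true , false , true) _ _ = _
orR-B (false , true , true) (true , true , false) _ _ = _
orR-B (false , true , true) (true , true , true) _ ()
orR-B (true , false , false) (false , false , false) _ _ = _
orR-B (true , false , false) (false , false , true) _ ()
orR-B (true , false , false) (false , true , false) _ _ = _
orR-B (true , false , false) (false , true , true) _ _ = _
orR-B (true , false , false) (true , false , false) _ _ = _
orR-B (true , false , false) (true , false , true) _ _ = _
orR-B (true , false , false) (true , true , false) _ _ = _
orR-B (true , false , false) (true , true , true) _ ()
orR-B (true , false , true) (false , false , false) _ _ = _
orR-B (true , false , true) (false , false , true) _ ()
orR-B (true , false , true) (false , true , false) _ _ = _
orR-B (true , false , true) (false , true , true) _ _ = _
orR-B (true , false , true) (true , false , false) _ _ = _
orR-B (true , false , true) (true , false , true) _ _ = _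
orR-B (true , false , true) (true , true , false) _ _ = _
orR-B (true , false , true) (true , true , true) _ ()
orR-B (true , true , false) (false , false , false) _ _ = _
orR-B (true , true , false) (false , false , true) _ ()
orR-B (true , true , false) (false , true , false) _ _ = _
orR-B (true , true , false) (false , true , true) _ _ = _
orR-B (true , true , false) (true , false , false) _ _ = _
orR-B (true , true , false) (true , false , true) _ _ = _
orR-B (true , true , false) (true , true , false) _ _ = _
orR-B (true , true , false) (true , true , true) _ ()
orR-B (true , true , true) (false , false , false) () _
orR-B (true , true , true) (false , false , true) () _
orR-B (true , true , true) (false , true , false) () _
orR-B (true , true , true) (false , true , true) () _
orR-B (true , true , true) (true , false , false) () _
orR-B (true , true , true) (true , false , true) () _
orR-B (true , true , true) (true , true , false) () _
orR-B (true , true , true) (true , true , true) () _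

impR-B : (z w : Triple) → T (isB z) → T (isB w) → T (isB (impR z w))
impR-B (false , false , false) (false , false , false) _ _ = _
impR-B (false , false , false) (false , false , true) _ ()
impR-B (false , false , false) (false , true , false) _ _ = _
impR-B (false , false , false) (false , true , true) _ _ = _
impR-B (false , false , false) (true , false , false) _ _ = _
impR-B (false , false , false) (true , false , true) _ _ = _
impR-B (false , false , false) (true , true , false) _ _ = _
impR-B (false , false , false) (true , true , true) _ ()
impR-B (false , false , true) (false , false , false) () _
impR-B (false , false , true) (false , false , true) () _
impR-B (false , false , true) (false , true , false) () _
impR-B (false , false , true) (false , true , true) () _
impR-B (false , false , true) (true , false , false) () _
impR-B (false , false , true) (true , false , true) () _
impR-B (false , false , true) (true , true , false) () _
impR-B (false , false , true) (true , true , true) () _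
impR-B (false , true , false) (false , false , false) _ _ = _
impR-B (false , true , false) (false , false , true) _ ()
impR-B (false , true , false) (false , true , false) _ _ = _
impR-B (false , true , false) (false , true , true) _ _ = _
impR-B (false , true , false) (true , false , false) _ _ = _
impR-B (false , true , false) (true , false , true) _ _ = _
impR-B (false , true , false) (true , true , false) _ _ = _
impR-B (false , true , false) (true , true , true) _ ()
impR-B (false , true , true) (false , false , false) _ _ = _
impR-B (false , true , true) (false , false , true) _ ()
impR-B (false , true , true) (false , true , false) _ _ = _
impR-B (false , true , true) (false , true , true) _ _ = _
impR-B (false , true , true) (true , false , false) _ _ = _
impR-B (false , true , true) (true , false , true) _ _ = _
impR-B (false , true , true) (true , true , false) _ _ = _
impR-B (false , true , true) (true , true , true) _ ()
impR-B (true , false , false) (false , false , false) _ _ = _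
impR-B (true , false , false) (false , false , true) _ ()
impR-B (true , false , false) (false , true , false) _ _ = _
impR-B (true , false , false) (false , true , true) _ _ = _
impR-B (true , false , false) (true , false , false) _ _ = _
impR-B (true , false , false) (true , false , true) _ _ = _
impR-B (true , false , false) (true , true , false) _ _ = _
impR-B (true , false , false) (true , true , true) _ ()
impR-B (true , false , true) (false , false , false) _ _ = _
impR-B (true , false , true) (false , false , true) _ ()
impR-B (true , false , true) (false , true , false) _ _ = _
impR-B (true , false , true) (false , true , true) _ _ = _
impR-B (true , false , true) (true , false , false) _ _ = _
impR-B (true , false , true) (true , false , true) _ _ = _
impR-B (true , false , true) (true , true , false) _ _ = _
impR-B (true , false , true) (true , true , true) _ ()
impR-B (true , true , false) (false , false , false) _ _ = _
impR-B (true , true , false) (false , false , true) _ ()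
impR-B (true , true , false) (false , true , false) _ _ = _
impR-B (true , true , false) (false , true , true) _ _ = _
impR-B (true , true , false) (true , false , false) _ _ = _
impR-B (true , true , false) (true , false , true) _ _ = _
impR-B (true , true , false) (true , true , false) _ _ = _
impR-B (true , true , false) (true , true , true) _ ()
impR-B (true , true , true) (false , false , false) () _
impR-B (true , true , true) (false , false , true) () _
impR-B (true , true , true) (false , true , false) () _
impR-B (true , true , true) (false , true , true) () _
impR-B (true , true , true) (true , false , false) () _
impR-B (true , true , true) (true , false , true) () _
impR-B (true , true , true) (true , true , false) () _
impR-B (true , true , true) (true , true , true) () _

negR-B : (z : Triple) → T (isB z) → T (isB (negR z))
negR-B (false , false , false) _ = _
negR-B (false , false , true) ()
negR-B (false , true , false) _ = _
negR-B (false , true , true) _ = _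
negR-B (true , false , false) _ = _
negR-B (true , false , true) _ = _
negR-B (true , true , false) _ = _
negR-B (true , true , true) ()

circR-B : (z : Triple) → T (isB z) → T (isB (circR z))
circR-B (false , false , false) _ = _
circR-B (false , false , true) ()
circR-B (false , true , false) _ = _
circR-B (false , true , true) _ = _
circR-B (true , false , false) _ = _
circR-B (true , false , true) _ = _
circR-B (true , true , false) _ = _
circR-B (true , true , true) ()

_∧̃_ : B → B → B
(z , p) ∧̃ (w , q) = andR z w , andR-B z w p q

_∨̃_ : B → B → B
(z , p) ∨̃ (w , q) = orR z w , orR-B z w p q

_→̃_ : B → B → B
(z , p) →̃ (w , q) = impR z w , impR-B z w p q

¬̃_ : B → B
¬̃ (z , p) = negR z , negR-B z p

∘̃_ : B → B
∘̃ (z , p) = circR z , circR-B z p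

infixr 6 _∧̃_
infixr 5 _∨̃_
infixr 4 _→̃_

Tt T₀ 𝖻 𝗇 F₀ Ff : B
Tt = (true , false , true) , _
T₀ = (true , false , false) , _
𝖻 = (true , true , false) , _
𝗇 = (false , false , false) , _
F₀ = (false , true , false) , _
Ff = (false , true , true) , _

Designated : B → Set
Designated z = (z ≡ Tt) ⊎ (z ≡ T₀) ⊎ (z ≡ 𝖻)

_↔̃_ : B → B → B
z ↔̃ w = (z →̃ w) ∧̃ (w →̃ z)

_≡̃_ : B → B → B
z ≡̃ w = ((z ↔̃ w) ∧̃ ((¬̃ z) ↔̃ (¬̃ w))) ∧̃ ((∘̃ z) ↔̃ (∘̃ w))

data Form : Set where
  var  : ℕ → Form
  _∧'_ : Form → Form → Form
  _∨'_ : Form → Form → Form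
  _⇒'_ : Form → Form → Form
  ¬'_  : Form → Form
  ∘'_  : Form → Form

-- A valuation (homomorphism from the formula algebra) is uniquely determined
-- by its values on variables; we represent it by the induced homomorphism.
⟦_⟧ : Form → (ℕ → B) → B
⟦ var n ⟧ e = e n
⟦ A ∧' C ⟧ e = ⟦ A ⟧ e ∧̃ ⟦ C ⟧ e
⟦ A ∨' C ⟧ e = ⟦ A ⟧ e ∨̃ ⟦ C ⟧ e
⟦ A ⇒' C ⟧ e = ⟦ A ⟧ e →̃ ⟦ C ⟧ e
⟦ ¬' A ⟧ e = ¬̃ ⟦ A ⟧ e
⟦ ∘' A ⟧ e = ∘̃ ⟦ A ⟧ e

_↔'_ : Form → Form → Form
A ↔' C = (A ⇒' C) ∧' (C ⇒' A)

_≡'_ : Form → Form → Form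
A ≡' C = ((A ↔' C) ∧' ((¬' A) ↔' (¬' C))) ∧' ((∘' A) ↔' (∘' C))

_⊨_ : List Form → Form → Set
Γ ⊨ A = (e : ℕ → B) → All (λ G → Designated (⟦ G ⟧ e)) Γ → Designated (⟦ A ⟧ e)

data UnOp : Set where
  neg circ : UnOp

data BinOp : Set where
  and or imp : BinOp

unF : UnOp → Form → Form
unF neg A = ¬' A
unF circ A = ∘' A

binF : BinOp → Form → Form → Form
binF and A C = A ∧' C
binF or A C = A ∨' C
binF imp A C = A ⇒' C

{-# OPTIONS --safe #-}
-- In 𝓜₆ an element is designated exactly when its first coordinate is 1, and the
-- first coordinate of z →̃ w is z₁ ⇒ w₁.  Hence z ↔̃ w is designated iff z₁ = w₁;
-- since ¬̃ and ∘̃ bring the second and third coordinates into first position,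
-- z ≡̃ w is designated iff z and w agree in all three coordinates.  Items (2)–(7)
-- then say that ≡' expresses equality of values, which is an equivalence and a
-- congruence.  For (8), z →̃ z has first coordinate 1 and equals z whenever z₁ = 1.
module Submission where

open import Defs
open import Data.Nat using (ℕ)
open import Data.Bool using (Bool; true; false; _∧_; T)
open import Data.Bool.Properties using (T-∧; T-irrelevant)
open import Data.Product using (_×_; _,_; proj₁)
open import Data.Product.Properties using (Σ-≡,≡→≡; ×-≡,≡→≡; ×-≡,≡←≡)
open import Data.Product.Function.NonDependent.Propositional using (_×-⇔_)
open import Data.List using ([]; _∷_)
open import Data.List.Relation.Unary.All using ([]; _∷_)
open import Data.Sum using (inj₁; inj₂)
open import Relation.Binary.PropositionalEquality using (_≡_; refl; sym; trans; cong; cong₂)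
open import Function.Bundles using (_⇔_; mk⇔; module Equivalence)
open import Function.Construct.Identity using (⇔-id)
open import Function.Related.Propositional using (module EquationalReasoning)

coord₁ : B → Bool
coord₁ ((z₁ , _ , _) , _) = z₁

designated⇔coord₁ : {z : B} → Designated z ⇔ T (coord₁ z)
designated⇔coord₁ {z} = mk⇔ to (from z)
  where
  to : {z : B} → Designated z → T (coord₁ z)
  to (inj₁ refl)        = _
  to (inj₂ (inj₁ refl)) = _
  to (inj₂ (inj₂ refl)) = _

  from : (z : B) → T (coord₁ z) → Designated z
  from ((true , false , true)  , _) _ = inj₁ refl
  from ((true , false , false) , _) _ = inj₂ (inj₁ refl)
  from ((true , true  , false) , _) _ = inj₂ (inj₂ refl)
  from ((true , true  , true)  , ()) _

T-⇒-⇐ : {a b : Bool} → T ((a ⇒ b) ∧ (b ⇒ a)) ⇔ (a ≡ b)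
T-⇒-⇐ {false} {false} = mk⇔ (λ _ → refl) (λ _ → _)
T-⇒-⇐ {false} {true}  = mk⇔ (λ ()) (λ ())
T-⇒-⇐ {true}  {false} = mk⇔ (λ ()) (λ ())
T-⇒-⇐ {true}  {true}  = mk⇔ (λ _ → refl) (λ _ → _)

proj₁-≡⇔≡ : {z w : B} → (proj₁ z ≡ proj₁ w) ⇔ (z ≡ w)
proj₁-≡⇔≡ = mk⇔ (λ p → Σ-≡,≡→≡ (p , T-irrelevant _ _)) (cong proj₁)

≡×≡×≡⇔≡ : {A₁ A₂ A₃ : Set} {x₁ y₁ : A₁} {x₂ y₂ : A₂} {x₃ y₃ : A₃} →
          ((x₁ ≡ y₁ × x₂ ≡ y₂) × (x₃ ≡ y₃)) ⇔ ((x₁ , x₂ , x₃) ≡ (y₁ , y₂ , y₃))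
≡×≡×≡⇔≡ = mk⇔ (λ { ((p , q) , r) → ×-≡,≡→≡ (p , ×-≡,≡→≡ (q , r)) })
              (λ e → let p , e′ = ×-≡,≡←≡ e ; q , r = ×-≡,≡←≡ e′ in (p , q) , r)

designated-≡̃⇔≡ : (z w : B) → Designated (z ≡̃ w) ⇔ (z ≡ w)
designated-≡̃⇔≡ z@((z₁ , z₂ , z₃) , _) w@((w₁ , w₂ , w₃) , _) = begin
  Designated (z ≡̃ w)                        ∼⟨ designated⇔coord₁ ⟩
  T (coord₁ (z ≡̃ w))                        ∼⟨ T-∧ ⟩
  _                                          ∼⟨ T-∧ ×-⇔ ⇔-id _ ⟩
  _                                          ∼⟨ (T-⇒-⇐ ×-⇔ T-⇒-⇐) ×-⇔ T-⇒-⇐ ⟩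
  ((z₁ ≡ w₁ × z₂ ≡ w₂) × z₃ ≡ w₃)            ∼⟨ ≡×≡×≡⇔≡ ⟩
  (z₁ , z₂ , z₃) ≡ (w₁ , w₂ , w₃)            ∼⟨ proj₁-≡⇔≡ ⟩
  z ≡ w                                      ∎
  where open EquationalReasoning

designated⇔fixes-→̃ : (z : B) → Designated z ⇔ (z ≡ (z →̃ z))
designated⇔fixes-→̃ z = mk⇔ (λ d → fixes z (Equivalence.to designated⇔coord₁ d)) (fixed z)
  where
  fixes : (z : B) → T (coord₁ z) → z ≡ (z →̃ z)
  fixes ((true , false , true)  , _) _ = refl
  fixes ((true , false , false) , _) _ = refl
  fixes ((true , true  , false) , _) _ = refl
  fixes ((true , true  , true)  , ()) _

  fixed : (z : B) → z ≡ (z →̃ z) → Designated z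
  fixed ((true , _ , _) , _) _ = Equivalence.from designated⇔coord₁ _
  fixed ((false , _ , _) , _) ()

⟦≡'⟧⇔≡ : (A C : Form) (e : ℕ → B) → Designated (⟦ A ≡' C ⟧ e) ⇔ (⟦ A ⟧ e ≡ ⟦ C ⟧ e)
⟦≡'⟧⇔≡ A C e = designated-≡̃⇔≡ (⟦ A ⟧ e) (⟦ C ⟧ e)

⟦unF⟧-cong : (u : UnOp) {A C : Form} {e : ℕ → B} →
             ⟦ A ⟧ e ≡ ⟦ C ⟧ e → ⟦ unF u A ⟧ e ≡ ⟦ unF u C ⟧ e
⟦unF⟧-cong neg  = cong ¬̃_
⟦unF⟧-cong circ = cong ∘̃_

⟦binF⟧-cong : (o : BinOp) {A C E G : Form} {e : ℕ → B} →
              ⟦ A ⟧ e ≡ ⟦ C ⟧ e → ⟦ E ⟧ e ≡ ⟦ G ⟧ e → ⟦ binF o A E ⟧ e ≡ ⟦ binF o C G ⟧ e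
⟦binF⟧-cong and = cong₂ _∧̃_
⟦binF⟧-cong or  = cong₂ _∨̃_
⟦binF⟧-cong imp = cong₂ _→̃_

proposition3p17 :
    ((z w : B) → Designated (z ≡̃ w) ⇔ (z ≡ w))
    × ((A C : Form) (e : ℕ → B) → Designated (⟦ A ≡' C ⟧ e) ⇔ (⟦ A ⟧ e ≡ ⟦ C ⟧ e))
    × ((A : Form) → [] ⊨ (A ≡' A))
    × ((A C : Form) → (A ≡' C ∷ []) ⊨ (C ≡' A))
    × ((A C E : Form) → (A ≡' C ∷ C ≡' E ∷ []) ⊨ (A ≡' E))
    × ((A C : Form) (u : UnOp) → (A ≡' C ∷ []) ⊨ (unF u A ≡' unF u C))
    × ((A C E G : Form) (o : BinOp) → (A ≡' C ∷ E ≡' G ∷ []) ⊨ (binF o A E ≡' binF o C G))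
    × ((A : Form) → ((A ≡' (A ⇒' A) ∷ []) ⊨ A) × ((A ∷ []) ⊨ (A ≡' (A ⇒' A))))
proposition3p17 =
    designated-≡̃⇔≡
  , ⟦≡'⟧⇔≡
  , (λ A e _ → from A A e refl)
  , (λ { A C e (h ∷ []) → from C A e (sym (to A C e h)) })
  , (λ { A C E e (h ∷ k ∷ []) → from A E e (trans (to A C e h) (to C E e k)) })
  , (λ { A C u e (h ∷ []) → from (unF u A) (unF u C) e (⟦unF⟧-cong u (to A C e h)) })
  , (λ { A C E G o e (h ∷ k ∷ []) →
           from (binF o A E) (binF o C G) e (⟦binF⟧-cong o (to A C e h) (to E G e k)) })
  , (λ A → (λ { e (h ∷ []) →
                  Equivalence.from (designated⇔fixes-→̃ (⟦ A ⟧ e)) (to A (A ⇒' A) e h) })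
         , (λ { e (h ∷ []) →
                  from A (A ⇒' A) e (Equivalence.to (designated⇔fixes-→̃ (⟦ A ⟧ e)) h) }))
  where
  to : (A C : Form) (e : ℕ → B) → Designated (⟦ A ≡' C ⟧ e) → ⟦ A ⟧ e ≡ ⟦ C ⟧ e
  to A C e = Equivalence.to (⟦≡'⟧⇔≡ A C e)

  from : (A C : Form) (e : ℕ → B) → ⟦ A ⟧ e ≡ ⟦ C ⟧ e → Designated (⟦ A ≡' C ⟧ e)
  from A C e = Equivalence.from (⟦≡'⟧⇔≡ A C e)
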